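{- Let $h\in\mathbb N$ and $\varepsilon>0$, and let $\delta=\delta(n)$ satisfy $\delta(n)/\log n\to\infty$ as $n\to\infty$. Then for all sufficiently large $n$, every $n$-vertex digraph $G$ with $\delta^+(G)\ge\delta(n)$ has a spanning subgraph $G'$ with $\delta^+(G')\ge\frac{1-\varepsilon}{2h}\delta(n)$ in which every closed walk of length at most $2h-1$ has type $0$.
   Context: Digraphs have no loops and no parallel edges (opposite edges allowed); $\delta^+$ is the minimum outdegree. A closed walk of a digraph is a closed walk $W=v_0e_0v_1e_1\cdots v_{s-1}e_{s-1}v_0$ in its underlying undirected graph. Its type $t(W)$ is the absolute value of $|\{i:e_i=(v_i,v_{i+1})\}|-|\{i:e_i=(v_{i+1},v_i)\}|$ (indices mod $s$), i.e. the net number of forward steps along the walk. -}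

module Defs where

open import Data.Nat as ℕ using (ℕ; zero; suc; _≤_; _^_)
open import Data.Bool using (Bool; true; false; if_then_else_)
open import Data.Fin using (Fin; inject₁; fromℕ) renaming (suc to fsuc; zero to fzero)
open import Data.List using (map; allFin)
open import Data.Nat.ListAction using (sum)
open import Data.Integer as ℤ using (ℤ; +_; ∣_∣)
open import Data.Product using (Σ; _×_; ∃)
open import Relation.Binary.PropositionalEquality using (_≡_)

-- A digraph on vertex set Fin n, given by its adjacency relation:
-- A u v ≡ true  iff  (u , v) is an arc.  Parallel arcs are impossible in this
-- encoding; opposite arcs are allowed.
Digraph : ℕ → Set
Digraph n = Fin n → Fin n → Bool

Loopless : ∀ {n} → Digraph n → Set
Loopless A = ∀ v → A v v ≡ false

countTrue : ∀ {m} → (Fin m → Bool) → ℕ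
countTrue {m} f = sum (map (λ i → if f i then 1 else 0) (allFin m))

outdeg : ∀ {n} → Digraph n → Fin n → ℕ
outdeg A u = countTrue (A u)

MinOutdegAtLeast : ∀ {n} → Digraph n → ℕ → Set
MinOutdegAtLeast A d = ∀ u → d ≤ outdeg A u

SpanningSub : ∀ {n} → Digraph n → Digraph n → Set
SpanningSub A' A = ∀ u v → A' u v ≡ true → A u v ≡ true

-- A closed walk of length s in the underlying graph of A:
-- vertices v 0, …, v s with v 0 = v s, and for each step i a direction bit
-- dir i : true means arc (v i , v (i+1)) is used (forward),
--         false means arc (v (i+1) , v i) is used (backward).
record ClosedWalk {n} (A : Digraph n) (s : ℕ) : Set where
  field
    vert   : Fin (suc s) → Fin n
    dir    : Fin s → Bool
    closed : vert fzero ≡ vert (fromℕ s)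
    step   : ∀ i → (if dir i
                     then A (vert (inject₁ i)) (vert (fsuc i))
                     else A (vert (fsuc i)) (vert (inject₁ i))) ≡ true

open ClosedWalk public

forwardSteps : ∀ {n} {A : Digraph n} {s} → ClosedWalk A s → ℕ
forwardSteps W = countTrue (dir W)

backwardSteps : ∀ {n} {A : Digraph n} {s} → ClosedWalk A s → ℕ
backwardSteps W = countTrue (λ i → if dir W i then false else true)

walkType : ∀ {n} {A : Digraph n} {s} → ClosedWalk A s → ℕ
walkType W = ∣ (+ forwardSteps W) ℤ.- (+ backwardSteps W) ∣

-- δ(n)/log n → ∞ (base of log irrelevant; use log₂):
-- for every M, eventually δ(n) ≥ M·log₂ n, i.e. n^M ≤ 2^δ(n).
SuperLog : (ℕ → ℕ) → Set
SuperLog δ = ∀ (M : ℕ) → ∃ λ N → ∀ n → N ≤ n → n ^ M ≤ 2 ^ δ n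

-- Colour the vertices by c : Fin n → ℤ/2h and keep exactly the arcs u → v with c v = c u + 1.
-- A forward step along a kept arc adds 1 to the colour and a backward step subtracts 1, so in a
-- closed walk the numbers of forward and backward steps agree mod 2h, hence agree outright when
-- the walk is shorter than 2h.  At a vertex with d ≥ δ out-neighbours the number Z of kept
-- out-arcs is Binomial(d, 1/2h).  Let a be the denominator of ε, K = a + 1 and L = 2hK.  Weighting
-- a colouring by a^Z K^(d−Z) (an exponential moment) shows that the proportion of colourings with
-- Z ≤ aδ/L is at most 2h·(α/β)^(δ/L), where α/β = (1 + 1/a)^a (1 − 1/L)^L < 1; as δ/log n → ∞
-- this is eventually below 1/n, and a union bound over the vertices leaves a colouring in which
-- every vertex keeps more than aδ/L ≥ (1 − ε)δ/2h out-arcs.  All probabilities are handled as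
-- counts of colourings in ℕ.

module Submission where

module FiniteSums where

  open import Defs using (countTrue)
  open import Data.Bool using (Bool; true; false; if_then_else_; not)
  open import Data.Fin using (Fin; zero; suc)
  open import Data.Fin.Properties using (_≟_)
  open import Data.List using (map; tabulate)
  open import Data.List.Properties using (map-tabulate)
  import Data.Nat.ListAction as List
  open import Data.Nat using (ℕ; zero; suc; _+_; _*_; _^_; _≤_; _<_; _<?_; z≤n; NonZero)
  open import Data.Nat.Properties hiding (_≟_)
  open import Data.Nat.Tactic.RingSolver using (solve-∀)
  open import Data.Product using (∃; _,_)
  open import Function using (id; _∘_)
  open import Relation.Binary.PropositionalEquality
  open import Relation.Nullary using (Dec; yes; no; does)

  open import Algebra.Properties.Semiring.Sum +-*-semiring public
    using (sum; sum-syntax; sum-cong-≗; ∑-comm; ∑-distrib-+; *-distribˡ-sum; *-distribʳ-sum)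
  open import Algebra.Properties.CommutativeMonoid.Sum *-1-commutativeMonoid public
    using () renaming (sum to product; sum-cong-≗ to product-cong-≗; ∑-distrib-+ to product-distrib-*)

  indicator : Bool → ℕ
  indicator b = if b then 1 else 0

  count : ∀ {k} → (Fin k → Bool) → ℕ
  count {k} f = ∑[ i < k ] indicator (f i)

  sum-mono-≤ : ∀ {k} {f g : Fin k → ℕ} → (∀ i → f i ≤ g i) → sum f ≤ sum g
  sum-mono-≤ {zero}  f≤g = z≤n
  sum-mono-≤ {suc k} f≤g = +-mono-≤ (f≤g zero) (sum-mono-≤ (f≤g ∘ suc))

  product-mono-≤ : ∀ {k} {f g : Fin k → ℕ} → (∀ i → f i ≤ g i) → product f ≤ product g
  product-mono-≤ {zero}  f≤g = ≤-refl
  product-mono-≤ {suc k} f≤g = *-mono-≤ (f≤g zero) (product-mono-≤ (f≤g ∘ suc))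

  sum-const : ∀ k x → ∑[ i < k ] x ≡ k * x
  sum-const zero    x = refl
  sum-const (suc k) x = cong (x +_) (sum-const k x)

  sum-<-witness : ∀ {k} (f g : Fin k → ℕ) → sum f < sum g → ∃ λ i → f i < g i
  sum-<-witness {suc k} f g Σf<Σg with f zero <? g zero
  ... | yes f₀<g₀ = zero , f₀<g₀
  ... | no  f₀≮g₀ with sum-<-witness (f ∘ suc) (g ∘ suc)
                         (+-cancel-<-≥ (≮⇒≥ f₀≮g₀) Σf<Σg)
    where
    +-cancel-<-≥ : ∀ {x y u v} → y ≤ x → x + u < y + v → u < v
    +-cancel-<-≥ {x} {y} {u} {v} y≤x lt = +-cancelˡ-< x u v (<-≤-trans lt (+-monoˡ-≤ v y≤x))
  ... | i , fi<gi = suc i , fi<gi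

  k*f<M⇒sum<M : ∀ {k} .{{_ : NonZero k}} (f : Fin k → ℕ) M → (∀ i → k * f i < M) → sum f < M
  k*f<M⇒sum<M {k} f M kf<M = *-cancelˡ-≤ k (begin
    k * suc (sum f)                      ≡⟨ *-suc k (sum f) ⟩
    k + k * sum f                        ≡⟨ cong (k +_) (*-distribˡ-sum k f) ⟩
    k + ∑[ i < k ] (k * f i)             ≡⟨ cong (_+ ∑[ i < k ] (k * f i)) (trans (sum-const k 1) (*-identityʳ k)) ⟨
    ∑[ i < k ] 1 + ∑[ i < k ] (k * f i)  ≡⟨ ∑-distrib-+ (λ _ → 1) (λ i → k * f i) ⟨
    ∑[ i < k ] suc (k * f i)             ≤⟨ sum-mono-≤ kf<M ⟩
    ∑[ i < k ] M                         ≡⟨ sum-const k M ⟩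
    k * M                                ∎)
    where open ≤-Reasoning

  count-≤ : ∀ {k} (p : Fin k → Bool) → count p ≤ k
  count-≤ {k} p = ≤-trans (sum-mono-≤ (λ i → indicator≤1 (p i))) (≤-reflexive (trans (sum-const k 1) (*-identityʳ k)))
    where
    indicator≤1 : ∀ b → indicator b ≤ 1
    indicator≤1 true  = ≤-refl
    indicator≤1 false = z≤n

  sum≡0⇒≡0 : ∀ {k} (f : Fin k → ℕ) → sum f ≡ 0 → ∀ i → f i ≡ 0
  sum≡0⇒≡0 f Σf≡0 zero    = m+n≡0⇒m≡0 (f zero) Σf≡0
  sum≡0⇒≡0 f Σf≡0 (suc i) = sum≡0⇒≡0 (f ∘ suc) (m+n≡0⇒n≡0 (f zero) Σf≡0) i

  sum-if-≟ : ∀ {k} (t : Fin (suc k)) x y → ∑[ i < suc k ] (if does (i ≟ t) then x else y) ≡ x + k * y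
  sum-if-≟ {k}     zero    x y = cong (x +_) (sum-const k y)
  sum-if-≟ {suc k} (suc t) x y = trans (cong (y +_) (sum-if-≟ t x y)) (x+[y+z]≡y+[x+z] y x (k * y))
    where
    x+[y+z]≡y+[x+z] : ∀ x y z → x + (y + z) ≡ y + (x + z)
    x+[y+z]≡y+[x+z] = solve-∀

  count-≟ : ∀ {k} (t : Fin k) → count (λ i → does (t ≟ i)) ≡ 1
  count-≟ {suc k} zero    = cong suc (trans (sum-const k 0) (*-zeroʳ k))
  count-≟ {suc k} (suc t) = count-≟ t

  product-^ : ∀ {k} x (e : Fin k → ℕ) → product (λ i → x ^ e i) ≡ x ^ sum e
  product-^ {zero}  x e = refl
  product-^ {suc k} x e = trans (cong (x ^ e zero *_) (product-^ x (e ∘ suc)))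
                                (sym (^-distribˡ-+-* x (e zero) (sum (e ∘ suc))))

  product-zero : ∀ {k} (f : Fin k → ℕ) i → f i ≡ 0 → product f ≡ 0
  product-zero f zero    fi≡0 = cong (_* product (f ∘ suc)) fi≡0
  product-zero f (suc i) fi≡0 = trans (cong (f zero *_) (product-zero (f ∘ suc) i fi≡0)) (*-zeroʳ (f zero))

  product-if : ∀ {k} (p : Fin k → Bool) x y →
               product (λ i → if p i then x else y) ≡ x ^ count p * y ^ count (not ∘ p)
  product-if p x y = begin
    product (λ i → if p i then x else y)
      ≡⟨ product-cong-≗ (λ i → split (p i)) ⟩
    product (λ i → x ^ indicator (p i) * y ^ indicator (not (p i)))
      ≡⟨ product-distrib-* (λ i → x ^ indicator (p i)) (λ i → y ^ indicator (not (p i))) ⟩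
    product (λ i → x ^ indicator (p i)) * product (λ i → y ^ indicator (not (p i)))
      ≡⟨ cong₂ _*_ (product-^ x (indicator ∘ p)) (product-^ y (indicator ∘ not ∘ p)) ⟩
    x ^ count p * y ^ count (not ∘ p)
      ∎
    where
    open ≡-Reasoning
    split : ∀ b → (if b then x else y) ≡ x ^ indicator b * y ^ indicator (not b)
    split true  = sym (trans (*-identityʳ (x * 1)) (*-identityʳ x))
    split false = sym (trans (+-identityʳ (y * 1)) (*-identityʳ y))

  *-indicator-≤ : ∀ {p} {P : Set p} (P? : Dec P) {x y} → (P → x ≤ y) → x * indicator (does P?) ≤ y
  *-indicator-≤ (yes p) {x} x≤y = ≤-trans (≤-reflexive (*-identityʳ x)) (x≤y p)
  *-indicator-≤ (no  _) {x} _   = ≤-trans (≤-reflexive (*-zeroʳ x)) z≤n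

  countTrue≡count : ∀ {k} (p : Fin k → Bool) → countTrue p ≡ count p
  countTrue≡count {zero}  p = refl
  countTrue≡count {suc k} p = cong (indicator (p zero) +_) (begin
    List.sum (map (indicator ∘ p) (tabulate suc))   ≡⟨ cong List.sum (map-tabulate suc (indicator ∘ p)) ⟩
    List.sum (tabulate (indicator ∘ p ∘ suc))       ≡⟨ cong List.sum (map-tabulate id (indicator ∘ p ∘ suc)) ⟨
    countTrue (p ∘ suc)                             ≡⟨ countTrue≡count (p ∘ suc) ⟩
    count (p ∘ suc)                                 ∎)
    where open ≡-Reasoning

  count+count-not : ∀ {k} (p : Fin k → Bool) → count p + count (not ∘ p) ≡ k
  count+count-not {zero}  p = refl
  count+count-not {suc k} p with p zero
  ... | true  = cong suc (count+count-not (p ∘ suc))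
  ... | false = trans (+-suc _ _) (cong suc (count+count-not (p ∘ suc)))

module Colourings where

  open FiniteSums
  open import Defs using (Digraph; SpanningSub)
  open import Data.Bool using (Bool; true; false; if_then_else_; not; _∧_)
  open import Data.Fin using (Fin; zero; suc)
  open import Data.Fin.Properties using (_≟_)
  open import Data.Nat using (ℕ; zero; suc; _+_; _*_; _^_; _∸_; _≤_; _<_; _≤?_; NonZero)
  open import Data.Nat.Properties hiding (_≟_)
  open import Data.Product using (∃; _,_)
  open import Data.Vec.Functional using (_∷_)
  open import Function using (_∘_)
  open import Relation.Binary.PropositionalEquality
  open import Relation.Nullary using (Dec; yes; no; does; ¬_)
  open import Relation.Nullary.Decidable using (dec-true; dec-false)

  Colouring : ℕ → ℕ → Set
  Colouring n m = Fin n → Fin m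

  ∑-colourings : ∀ m n → (Colouring n m → ℕ) → ℕ
  ∑-colourings m zero    F = F (λ ())
  ∑-colourings m (suc n) F = ∑[ j < m ] ∑-colourings m n (λ c → F (j ∷ c))

  module _ (m : ℕ) where

    ∑-colourings-cong : ∀ n {F G : Colouring n m → ℕ} → (∀ c → F c ≡ G c) →
                        ∑-colourings m n F ≡ ∑-colourings m n G
    ∑-colourings-cong zero    F≗G = F≗G _
    ∑-colourings-cong (suc n) F≗G = sum-cong-≗ (λ j → ∑-colourings-cong n (λ c → F≗G (j ∷ c)))

    ∑-colourings-mono-≤ : ∀ n {F G : Colouring n m → ℕ} → (∀ c → F c ≤ G c) →
                          ∑-colourings m n F ≤ ∑-colourings m n G
    ∑-colourings-mono-≤ zero    F≤G = F≤G _
    ∑-colourings-mono-≤ (suc n) F≤G = sum-mono-≤ (λ j → ∑-colourings-mono-≤ n (λ c → F≤G (j ∷ c)))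

    ∑-colourings-*ˡ : ∀ n x (F : Colouring n m → ℕ) →
                      ∑-colourings m n (λ c → x * F c) ≡ x * ∑-colourings m n F
    ∑-colourings-*ˡ zero    x F = refl
    ∑-colourings-*ˡ (suc n) x F = trans (sum-cong-≗ (λ j → ∑-colourings-*ˡ n x (λ c → F (j ∷ c))))
                                        (sym (*-distribˡ-sum x (λ j → ∑-colourings m n (F ∘ (j ∷_)))))

    ∑-colourings-1 : ∀ n → ∑-colourings m n (λ _ → 1) ≡ m ^ n
    ∑-colourings-1 zero    = refl
    ∑-colourings-1 (suc n) = trans (sum-cong-≗ {m} (λ _ → ∑-colourings-1 n)) (sum-const m (m ^ n))

    ∑-colourings-<-witness : ∀ n (F G : Colouring n m → ℕ) →
                             ∑-colourings m n F < ∑-colourings m n G → ∃ λ c → F c < G c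
    ∑-colourings-<-witness zero    F G F<G = _ , F<G
    ∑-colourings-<-witness (suc n) F G ΣF<ΣG
      with sum-<-witness (λ j → ∑-colourings m n (F ∘ (j ∷_))) (λ j → ∑-colourings m n (G ∘ (j ∷_))) ΣF<ΣG
    ... | j , F<G with ∑-colourings-<-witness n (F ∘ (j ∷_)) (G ∘ (j ∷_)) F<G
    ... | c , Fc<Gc = j ∷ c , Fc<Gc

    ∑-colourings-∑-comm : ∀ n {k} (B : Fin k → Colouring n m → ℕ) →
                          ∑-colourings m n (λ c → ∑[ u < k ] B u c) ≡ ∑[ u < k ] ∑-colourings m n (B u)
    ∑-colourings-∑-comm zero    B = refl
    ∑-colourings-∑-comm (suc n) B = trans
      (sum-cong-≗ (λ j → ∑-colourings-∑-comm n (λ u c → B u (j ∷ c))))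
      (∑-comm (λ j u → ∑-colourings m n (λ c → B u (j ∷ c))))

    ∑-colourings-product : ∀ n (f : Fin n → Fin m → ℕ) →
                           ∑-colourings m n (λ c → product (λ v → f v (c v))) ≡ product (λ v → sum (f v))
    ∑-colourings-product zero    f = refl
    ∑-colourings-product (suc n) f = begin
      ∑[ j < m ] ∑-colourings m n (λ c → f zero j * product (λ v → f (suc v) (c v)))
        ≡⟨ sum-cong-≗ (λ j → ∑-colourings-*ˡ n (f zero j) _) ⟩
      ∑[ j < m ] (f zero j * ∑-colourings m n (λ c → product (λ v → f (suc v) (c v))))
        ≡⟨ sym (*-distribʳ-sum _ (f zero)) ⟩
      sum (f zero) * ∑-colourings m n (λ c → product (λ v → f (suc v) (c v)))
        ≡⟨ cong (sum (f zero) *_) (∑-colourings-product n (f ∘ suc)) ⟩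
      sum (f zero) * product (λ v → sum (f (suc v)))
        ∎
      where open ≡-Reasoning

  good-colouring-exists : ∀ {n m ℓ} .{{_ : NonZero n}} {Bad : Fin n → Colouring n m → Set ℓ}
                          (bad? : ∀ u c → Dec (Bad u c)) →
                          (∀ u → n * ∑-colourings m n (λ c → indicator (does (bad? u c))) < m ^ n) →
                          ∃ λ c → ∀ u → ¬ Bad u c
  good-colouring-exists {n} {m} bad? few-bad
    with ∑-colourings-<-witness m n (λ c → ∑[ u < n ] indicator (does (bad? u c))) (λ _ → 1) union-bound
    where
    union-bound : ∑-colourings m n (λ c → ∑[ u < n ] indicator (does (bad? u c))) < ∑-colourings m n (λ _ → 1)
    union-bound rewrite ∑-colourings-∑-comm m n (λ u c → indicator (does (bad? u c))) | ∑-colourings-1 m n =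
      k*f<M⇒sum<M (λ u → ∑-colourings m n (λ c → indicator (does (bad? u c)))) (m ^ n) few-bad
  ... | c , no-bad-at-c = c , λ u → indicator≡0⇒¬ (bad? u c)
                                     (sum≡0⇒≡0 (λ u → indicator (does (bad? u c))) (n<1⇒n≡0 no-bad-at-c) u)
    where
    indicator≡0⇒¬ : ∀ {p} {P : Set p} (P? : Dec P) → indicator (does P?) ≡ 0 → ¬ P
    indicator≡0⇒¬ (no ¬p) _ = ¬p

  exponential-markov : ∀ {a b z t w D} → a ≤ b → z ≤ t → b ^ z * w ≡ a ^ z * D → a ^ t * D ≤ b ^ t * w
  exponential-markov {a} {b} {z} {t} {w} {D} a≤b z≤t bᶻw≡aᶻD = begin
    a ^ t * D               ≡⟨ cong (λ e → a ^ e * D) (sym r+z≡t) ⟩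
    a ^ (r + z) * D         ≡⟨ cong (_* D) (^-distribˡ-+-* a r z) ⟩
    a ^ r * a ^ z * D       ≡⟨ *-assoc (a ^ r) (a ^ z) D ⟩
    a ^ r * (a ^ z * D)     ≡⟨ cong (a ^ r *_) (sym bᶻw≡aᶻD) ⟩
    a ^ r * (b ^ z * w)     ≤⟨ *-monoˡ-≤ (b ^ z * w) (^-monoˡ-≤ r a≤b) ⟩
    b ^ r * (b ^ z * w)     ≡⟨ sym (*-assoc (b ^ r) (b ^ z) w) ⟩
    b ^ r * b ^ z * w       ≡⟨ cong (_* w) (sym (^-distribˡ-+-* b r z)) ⟩
    b ^ (r + z) * w         ≡⟨ cong (λ e → b ^ e * w) r+z≡t ⟩
    b ^ t * w               ∎
    where
    open ≤-Reasoning
    r = t ∸ z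
    r+z≡t : r + z ≡ t
    r+z≡t = m∸n+n≡m z≤t

  colourSubgraph : ∀ {n m} → (Fin m → Fin m) → Colouring n m → Digraph n → Digraph n
  colourSubgraph next c G u v = G u v ∧ does (c v ≟ next (c u))

  colourSubgraph-⊆ : ∀ {n m} (next : Fin m → Fin m) (c : Colouring n m) (G : Digraph n) →
                     SpanningSub (colourSubgraph next c G) G
  colourSubgraph-⊆ next c G u v arc with G u v
  ... | true = refl

  colourSubgraph-arc : ∀ {n m} (next : Fin m → Fin m) (c : Colouring n m) (G : Digraph n) u v →
                       colourSubgraph next c G u v ≡ true → c v ≡ next (c u)
  colourSubgraph-arc next c G u v arc with G u v | c v ≟ next (c u)
  ... | true | yes cv≡next = cv≡next

  hits : ∀ {n m} → (Fin m → Fin m) → Colouring n m → Digraph n → Fin n → ℕ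
  hits next c G u = count (colourSubgraph next c G u)

  module _ {n m′ : ℕ} (next : Fin (suc m′) → Fin (suc m′)) (G : Digraph n)
           (u : Fin n) (G-u-u : G u u ≡ false) (a b : ℕ) where

    private
      m = suc m′
      d = count (G u)
      d̄ = count (not ∘ G u)

    hitFactor : Fin m → Fin n → Fin m → ℕ
    hitFactor j v x = if G u v then (if does (x ≟ next j) then a else b) else 1

    weight : Colouring n m → ℕ
    weight c = product (λ v → hitFactor (c u) v (c v))

    weight-hits : ∀ c → b ^ hits next c G u * weight c ≡ a ^ hits next c G u * b ^ d
    weight-hits c = begin
      b ^ hits next c G u * weight c
        ≡⟨ cong (_* weight c) (sym (product-^ b e)) ⟩
      product (λ v → b ^ e v) * product f
        ≡⟨ sym (product-distrib-* (λ v → b ^ e v) f) ⟩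
      product (λ v → b ^ e v * f v)
        ≡⟨ product-cong-≗ (λ v → pointwise (G u v) (does (c v ≟ next (c u)))) ⟩
      product (λ v → a ^ e v * b ^ indicator (G u v))
        ≡⟨ product-distrib-* (λ v → a ^ e v) (λ v → b ^ indicator (G u v)) ⟩
      product (λ v → a ^ e v) * product (λ v → b ^ indicator (G u v))
        ≡⟨ cong₂ _*_ (product-^ a e) (product-^ b (indicator ∘ G u)) ⟩
      a ^ hits next c G u * b ^ d
        ∎
      where
      open ≡-Reasoning
      e = λ v → indicator (colourSubgraph next c G u v)
      f = λ v → hitFactor (c u) v (c v)
      pointwise : ∀ p q → b ^ indicator (p ∧ q) * (if p then (if q then a else b) else 1)
                          ≡ a ^ indicator (p ∧ q) * b ^ indicator p
      pointwise true  true  = trans (cong (_* a) (*-identityʳ b))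
                                    (trans (*-comm b a) (sym (cong₂ _*_ (*-identityʳ a) (*-identityʳ b))))
      pointwise true  false = cong (1 *_) (sym (*-identityʳ b))
      pointwise false q     = refl

    -- Pinning the colour of u to j turns the weight into a product of independent per-vertex factors.
    pinnedFactor : Fin m → Fin n → Fin m → ℕ
    pinnedFactor j v x = if does (v ≟ u) then indicator (does (x ≟ j)) else hitFactor j v x

    pinned-product : ∀ c j → product (λ v → pinnedFactor j v (c v)) ≡ indicator (does (c u ≟ j)) * weight c
    pinned-product c j with c u ≟ j
    ... | yes refl = trans (product-cong-≗ unpinned) (sym (+-identityʳ (weight c)))
      where
      unpinned : ∀ v → pinnedFactor (c u) v (c v) ≡ hitFactor (c u) v (c v)
      unpinned v with v ≟ u
      ... | yes refl rewrite G-u-u | dec-true (c u ≟ c u) refl = refl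
      ... | no  _    = refl
    ... | no  cu≢j = product-zero (λ v → pinnedFactor j v (c v)) u
                       (cong₂ (λ p q → if p then indicator q else hitFactor j u (c u))
                              (dec-true (u ≟ u) refl) (dec-false (c u ≟ j) cu≢j))

    weight-pinned : ∀ c → weight c ≡ ∑[ j < m ] product (λ v → pinnedFactor j v (c v))
    weight-pinned c = sym (begin
      ∑[ j < m ] product (λ v → pinnedFactor j v (c v))
        ≡⟨ sum-cong-≗ (pinned-product c) ⟩
      ∑[ j < m ] (indicator (does (c u ≟ j)) * weight c)
        ≡⟨ sym (*-distribʳ-sum (weight c) (λ j → indicator (does (c u ≟ j)))) ⟩
      count (λ j → does (c u ≟ j)) * weight c
        ≡⟨ cong (_* weight c) (count-≟ (c u)) ⟩
      1 * weight c
        ≡⟨ *-identityˡ (weight c) ⟩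
      weight c
        ∎)
      where open ≡-Reasoning

    sum-pinnedFactor-≤ : ∀ j v → sum (pinnedFactor j v) ≤ (if G u v then a + m′ * b else m)
    sum-pinnedFactor-≤ j v with v ≟ u
    ... | yes refl rewrite G-u-u = count-≤ (λ x → does (x ≟ j))
    ... | no  _ with G u v
    ...   | true  = ≤-reflexive (sum-if-≟ (next j) a b)
    ...   | false = ≤-reflexive (trans (sum-const m 1) (*-identityʳ m))

    ∑-weight-≤ : ∑-colourings m n weight ≤ m * ((a + m′ * b) ^ d * m ^ d̄)
    ∑-weight-≤ = begin
      ∑-colourings m n weight
        ≡⟨ ∑-colourings-cong m n weight-pinned ⟩
      ∑-colourings m n (λ c → ∑[ j < m ] product (λ v → pinnedFactor j v (c v)))
        ≡⟨ ∑-colourings-∑-comm m n (λ j c → product (λ v → pinnedFactor j v (c v))) ⟩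
      ∑[ j < m ] ∑-colourings m n (λ c → product (λ v → pinnedFactor j v (c v)))
        ≡⟨ sum-cong-≗ (λ j → ∑-colourings-product m n (pinnedFactor j)) ⟩
      ∑[ j < m ] product (λ v → sum (pinnedFactor j v))
        ≤⟨ sum-mono-≤ (λ j → product-mono-≤ (sum-pinnedFactor-≤ j)) ⟩
      ∑[ j < m ] product (λ v → if G u v then a + m′ * b else m)
        ≡⟨ sum-const m _ ⟩
      m * product (λ v → if G u v then a + m′ * b else m)
        ≡⟨ cong (m *_) (product-if (G u) (a + m′ * b) m) ⟩
      m * ((a + m′ * b) ^ d * m ^ d̄)
        ∎
      where open ≤-Reasoning

    few-hits-≤ : a ≤ b → ∀ T →
      ∑-colourings m n (λ c → indicator (does (hits next c G u ≤? T))) * (a ^ T * b ^ d)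
        ≤ b ^ T * (m * ((a + m′ * b) ^ d * m ^ d̄))
    few-hits-≤ a≤b T = begin
      ∑-colourings m n (λ c → indicator (few c)) * X
        ≡⟨ *-comm _ X ⟩
      X * ∑-colourings m n (λ c → indicator (few c))
        ≡⟨ sym (∑-colourings-*ˡ m n X (λ c → indicator (few c))) ⟩
      ∑-colourings m n (λ c → X * indicator (few c))
        ≤⟨ ∑-colourings-mono-≤ m n markov ⟩
      ∑-colourings m n (λ c → b ^ T * weight c)
        ≡⟨ ∑-colourings-*ˡ m n (b ^ T) weight ⟩
      b ^ T * ∑-colourings m n weight
        ≤⟨ *-monoʳ-≤ (b ^ T) ∑-weight-≤ ⟩
      b ^ T * (m * ((a + m′ * b) ^ d * m ^ d̄))
        ∎
      where
      open ≤-Reasoning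
      X = a ^ T * b ^ d
      few = λ c → does (hits next c G u ≤? T)
      markov : ∀ c → X * indicator (few c) ≤ b ^ T * weight c
      markov c = *-indicator-≤ (hits next c G u ≤? T) (λ hits≤T → exponential-markov a≤b hits≤T (weight-hits c))

module CyclicWalks where

  open FiniteSums
  open Colourings using (Colouring)
  open import Defs using (Digraph; ClosedWalk; vert; dir; closed; step; forwardSteps; backwardSteps; walkType)
  open import Data.Bool using (Bool; true; false; if_then_else_; not)
  open import Data.Fin using (Fin; zero; suc; toℕ; fromℕ; inject₁)
  open import Data.Fin.Properties using (toℕ-fromℕ<; toℕ<n)
  import Data.Integer as ℤ
  open import Data.Integer.Properties using (+-inverseʳ)
  open import Data.Nat using (ℕ; zero; suc; _+_; _∸_; _≤_; _<_; s≤s; _<?_)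
  open import Data.Nat.DivMod using (_%_; _mod_; %-distribˡ-+; m%n%n≡m%n; m%n<n; m<n⇒m%n≡m; m≤n⇒[n∸m]%m≡n%m)
  open import Data.Nat.GeneralisedArithmetic using (iterate)
  open import Data.Nat.Properties hiding (_≟_)
  open import Data.Sum using (inj₁; inj₂)
  open import Function using (_∘_)
  open import Relation.Binary.PropositionalEquality
  open import Relation.Nullary using (yes; no)
  open import Relation.Nullary.Negation using (contradiction)

  iterate-suc : ∀ {A : Set} (f : A → A) x k → iterate f x (suc k) ≡ f (iterate f x k)
  iterate-suc f x zero    = refl
  iterate-suc f x (suc k) = iterate-suc f (f x) k

  iterate-+ : ∀ {A : Set} (f : A → A) x j k → iterate f x (j + k) ≡ iterate f (iterate f x j) k
  iterate-+ f x zero    k = refl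
  iterate-+ f x (suc j) k = iterate-+ f (f x) j k

  module _ {n m} (next : Fin m → Fin m) (c : Colouring n m) (A : Digraph n)
           (arc-next : ∀ u v → A u v ≡ true → c v ≡ next (c u)) where

    walk-balance : ∀ s (vert : Fin (suc s) → Fin n) (dir : Fin s → Bool) →
      (∀ i → (if dir i then A (vert (inject₁ i)) (vert (suc i))
                       else A (vert (suc i)) (vert (inject₁ i))) ≡ true) →
      iterate next (c (vert (fromℕ s))) (count (not ∘ dir)) ≡ iterate next (c (vert zero)) (count dir)
    walk-balance zero    vert dir step = refl
    walk-balance (suc s) vert dir step with dir zero | step zero | walk-balance s (vert ∘ suc) (dir ∘ suc) (step ∘ suc)
    ... | true  | arc | balance = trans balance (cong (λ x → iterate next x (count (dir ∘ suc))) (arc-next _ _ arc))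
    ... | false | arc | balance = begin
      iterate next (c (vert (fromℕ (suc s)))) (suc (count (not ∘ dir ∘ suc)))
        ≡⟨ iterate-suc next (c (vert (fromℕ (suc s)))) (count (not ∘ dir ∘ suc)) ⟩
      next (iterate next (c (vert (fromℕ (suc s)))) (count (not ∘ dir ∘ suc)))
        ≡⟨ cong next balance ⟩
      next (iterate next (c (vert (suc zero))) (count (dir ∘ suc)))
        ≡⟨ iterate-suc next (c (vert (suc zero))) (count (dir ∘ suc)) ⟨
      iterate next (next (c (vert (suc zero)))) (count (dir ∘ suc))
        ≡⟨ cong (λ x → iterate next x (count (dir ∘ suc))) (arc-next _ _ arc) ⟨
      iterate next (c (vert zero)) (count (dir ∘ suc))
        ∎
      where open ≡-Reasoning

  module _ {m′ : ℕ} where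

    private
      m = suc m′

    cyclicSuc : Fin m → Fin m
    cyclicSuc j = (toℕ j + 1) mod m

    [x%m+y]%m≡[x+y]%m : ∀ x y → (x % m + y) % m ≡ (x + y) % m
    [x%m+y]%m≡[x+y]%m x y = begin
      (x % m + y) % m             ≡⟨ %-distribˡ-+ (x % m) y m ⟩
      (x % m % m + y % m) % m     ≡⟨ cong (λ z → (z + y % m) % m) (m%n%n≡m%n x m) ⟩
      (x % m + y % m) % m         ≡⟨ %-distribˡ-+ x y m ⟨
      (x + y) % m                 ∎
      where open ≡-Reasoning

    toℕ-iterate-cyclicSuc : ∀ x k → toℕ (iterate cyclicSuc x k) ≡ (toℕ x + k) % m
    toℕ-iterate-cyclicSuc x zero    = sym (trans (cong (_% m) (+-identityʳ (toℕ x))) (m<n⇒m%n≡m (toℕ<n x)))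
    toℕ-iterate-cyclicSuc x (suc k) = begin
      toℕ (iterate cyclicSuc x (suc k))           ≡⟨ cong toℕ (iterate-suc cyclicSuc x k) ⟩
      toℕ (cyclicSuc (iterate cyclicSuc x k))     ≡⟨ toℕ-fromℕ< (m%n<n (toℕ (iterate cyclicSuc x k) + 1) m) ⟩
      (toℕ (iterate cyclicSuc x k) + 1) % m       ≡⟨ cong (λ z → (z + 1) % m) (toℕ-iterate-cyclicSuc x k) ⟩
      ((toℕ x + k) % m + 1) % m                   ≡⟨ [x%m+y]%m≡[x+y]%m (toℕ x + k) 1 ⟩
      (toℕ x + k + 1) % m                         ≡⟨ cong (_% m) (trans (+-assoc (toℕ x) k 1) (cong (toℕ x +_) (+-comm k 1))) ⟩
      (toℕ x + suc k) % m                         ∎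
      where open ≡-Reasoning

    [y+k]%m≡y⇒k≡0 : ∀ y k → y < m → k < m → (y + k) % m ≡ y → k ≡ 0
    [y+k]%m≡y⇒k≡0 y k y<m k<m [y+k]%m≡y with y + k <? m
    ... | yes y+k<m = +-cancelˡ-≡ y k 0 (trans (sym (m<n⇒m%n≡m y+k<m)) (trans [y+k]%m≡y (sym (+-identityʳ y))))
    ... | no  y+k≮m = contradiction (+-cancelˡ-≡ y k m y+k≡y+m) (<⇒≢ k<m)
      where
      m≤y+k = ≮⇒≥ y+k≮m
      y+k∸m<m : y + k ∸ m < m
      y+k∸m<m = +-cancelʳ-< m (y + k ∸ m) m
                  (subst (_< m + m) (sym (m∸n+n≡m m≤y+k)) (+-mono-< y<m k<m))
      y+k≡y+m : y + k ≡ y + m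
      y+k≡y+m = begin
        y + k                   ≡⟨ m∸n+n≡m m≤y+k ⟨
        y + k ∸ m + m           ≡⟨ cong (_+ m) (m<n⇒m%n≡m y+k∸m<m) ⟨
        (y + k ∸ m) % m + m     ≡⟨ cong (_+ m) (m≤n⇒[n∸m]%m≡n%m m≤y+k) ⟩
        (y + k) % m + m         ≡⟨ cong (_+ m) [y+k]%m≡y ⟩
        y + m                   ∎
        where open ≡-Reasoning

    cyclicSuc-no-short-cycle : ∀ x k → iterate cyclicSuc x k ≡ x → k < m → k ≡ 0
    cyclicSuc-no-short-cycle x k cycle k<m =
      [y+k]%m≡y⇒k≡0 (toℕ x) k (toℕ<n x) k<m (trans (sym (toℕ-iterate-cyclicSuc x k)) (cong toℕ cycle))

    iterate-cyclicSuc-injective-≤ : ∀ x {i l} → i ≤ l → l < m →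
                                    iterate cyclicSuc x l ≡ iterate cyclicSuc x i → l ≡ i
    iterate-cyclicSuc-injective-≤ x {i} {l} i≤l l<m eq = ≤-antisym (m∸n≡0⇒m≤n l∸i≡0) i≤l
      where
      l∸i≡0 : l ∸ i ≡ 0
      l∸i≡0 = cyclicSuc-no-short-cycle (iterate cyclicSuc x i) (l ∸ i)
                (trans (sym (iterate-+ cyclicSuc x i (l ∸ i))) (trans (cong (iterate cyclicSuc x) (m+[n∸m]≡n i≤l)) eq))
                (≤-<-trans (m∸n≤m l i) l<m)

    iterate-cyclicSuc-injective : ∀ x {j k} → j + k < m → iterate cyclicSuc x j ≡ iterate cyclicSuc x k → j ≡ k
    iterate-cyclicSuc-injective x {j} {k} j+k<m eq with ≤-total j k
    ... | inj₁ j≤k = sym (iterate-cyclicSuc-injective-≤ x j≤k (≤-<-trans (m≤n+m k j) j+k<m) (sym eq))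
    ... | inj₂ k≤j = iterate-cyclicSuc-injective-≤ x k≤j (≤-<-trans (m≤m+n j k) j+k<m) eq

  forwardSteps≡count : ∀ {n s} {A : Digraph n} (W : ClosedWalk A s) → forwardSteps W ≡ count (dir W)
  forwardSteps≡count W = countTrue≡count (dir W)

  backwardSteps≡count : ∀ {n s} {A : Digraph n} (W : ClosedWalk A s) → backwardSteps W ≡ count (not ∘ dir W)
  backwardSteps≡count W = trans (countTrue≡count (λ i → if dir W i then false else true))
                                (sum-cong-≗ (λ i → cong indicator (if-then-false-else-true (dir W i))))
    where
    if-then-false-else-true : ∀ b → (if b then false else true) ≡ not b
    if-then-false-else-true true  = refl
    if-then-false-else-true false = refl

  closedWalk-type-zero : ∀ {n m′} (c : Colouring n (suc m′)) (A : Digraph n) →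
                         (∀ u v → A u v ≡ true → c v ≡ cyclicSuc (c u)) →
                         ∀ {s} → s ≤ m′ → (W : ClosedWalk A s) → walkType W ≡ 0
  closedWalk-type-zero {m′ = m′} c A arc-next {s} s≤m′ W = begin
    ℤ.∣ ℤ.+ F ℤ.- ℤ.+ B ∣   ≡⟨ cong (λ x → ℤ.∣ ℤ.+ x ℤ.- ℤ.+ B ∣) F≡B ⟩
    ℤ.∣ ℤ.+ B ℤ.- ℤ.+ B ∣   ≡⟨ cong ℤ.∣_∣ (+-inverseʳ (ℤ.+ B)) ⟩
    0                       ∎
    where
    open ≡-Reasoning
    F = forwardSteps W
    B = backwardSteps W
    x₀ = c (vert W zero)
    F+B<m : F + B < suc m′
    F+B<m = s≤s (≤-trans (≤-reflexive (trans (cong₂ _+_ (forwardSteps≡count W) (backwardSteps≡count W))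
                                             (count+count-not (dir W))))
                         s≤m′)
    balanced : iterate cyclicSuc x₀ F ≡ iterate cyclicSuc x₀ B
    balanced = begin
      iterate cyclicSuc x₀ F                                          ≡⟨ cong (iterate cyclicSuc x₀) (forwardSteps≡count W) ⟩
      iterate cyclicSuc x₀ (count (dir W))                            ≡⟨ walk-balance cyclicSuc c A arc-next s (vert W) (dir W) (step W) ⟨
      iterate cyclicSuc (c (vert W (fromℕ s))) (count (not ∘ dir W))  ≡⟨ cong₂ (λ v k → iterate cyclicSuc (c v) k) (closed W) (backwardSteps≡count W) ⟨
      iterate cyclicSuc x₀ B                                          ∎
    F≡B : F ≡ B
    F≡B = iterate-cyclicSuc-injective x₀ F+B<m balanced

module TailEstimate where

  open import Data.Nat
  open import Data.Nat.DivMod using (m*n/n≡m; /-monoˡ-≤)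
  open import Data.Nat.Properties
  open import Data.Nat.Tactic.RingSolver using (solve-∀)
  open import Relation.Binary.PropositionalEquality
  open import Relation.Nullary using (yes; no)
  open import Relation.Nullary.Negation using (contradiction)

  ^-distribʳ-* : ∀ x y k → (x * y) ^ k ≡ x ^ k * y ^ k
  ^-distribʳ-* x y zero    = refl
  ^-distribʳ-* x y (suc k) = trans (cong (x * y *_) (^-distribʳ-* x y k)) (xy[XY]≡xX[yY] x y (x ^ k) (y ^ k))
    where
    xy[XY]≡xX[yY] : ∀ x y X Y → x * y * (X * Y) ≡ x * X * (y * Y)
    xy[XY]≡xX[yY] = solve-∀

  ^-cancelʳ-< : ∀ {x y} k → x ^ k < y ^ k → x < y
  ^-cancelʳ-< {x} {y} k xᵏ<yᵏ with x <? y
  ... | yes x<y = x<y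
  ... | no  x≮y = contradiction xᵏ<yᵏ (≤⇒≯ (^-monoˡ-≤ k (≮⇒≥ x≮y)))

  -- (1 + 1/x)^k ≥ 1 + k/x, multiplied out.
  bernoulli : ∀ x k → x ^ k * (x + k) ≤ (x + 1) ^ k * x
  bernoulli x zero    = ≤-reflexive (cong (_+ 0) (+-identityʳ x))
  bernoulli x (suc k) = begin
    x * x ^ k * (x + suc k)                    ≡⟨ split x (x ^ k) k ⟩
    x * (x ^ k * (x + k)) + x * x ^ k          ≤⟨ +-mono-≤ (*-monoʳ-≤ x (bernoulli x k))
                                                            (*-monoʳ-≤ x (^-monoˡ-≤ k (m≤m+n x 1))) ⟩
    x * ((x + 1) ^ k * x) + x * (x + 1) ^ k    ≡⟨ merge x ((x + 1) ^ k) ⟩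
    (x + 1) * (x + 1) ^ k * x                  ∎
    where
    open ≤-Reasoning
    split : ∀ x X k → x * X * (x + suc k) ≡ x * (X * (x + k)) + x * X
    split = solve-∀
    merge : ∀ x E → x * (E * x) + x * E ≡ (x + 1) * E * x
    merge = solve-∀

  -- (1 − 1/(q + 1))^k ≥ 1 − k/(q + 1), multiplied out.
  bernoulli-down : ∀ q k → (q + 1) ^ suc k ≤ q ^ k * (q + 1) + k * (q + 1) ^ k
  bernoulli-down q zero    = ≤-reflexive (base q)
    where
    base : ∀ q → (q + 1) * 1 ≡ 1 * (q + 1) + 0
    base = solve-∀
  bernoulli-down q (suc k) = ≤-trans (m≤m+n _ (k * E)) (+-cancelʳ-≤ (k * q * E) _ _ (begin
    (q + 1) * ((q + 1) * E) + k * E + k * q * E        ≡⟨ regroup q E k ⟩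
    q * ((q + 1) * E) + suc k * ((q + 1) * E)          ≤⟨ +-monoˡ-≤ _ (*-monoʳ-≤ q (bernoulli-down q k)) ⟩
    q * (q ^ k * (q + 1) + k * E) + suc k * ((q + 1) * E)
                                                       ≡⟨ expand q E k (q ^ k) ⟩
    q * q ^ k * (q + 1) + suc k * ((q + 1) * E) + k * q * E ∎))
    where
    open ≤-Reasoning
    E = (q + 1) ^ k
    regroup : ∀ q E k → (q + 1) * ((q + 1) * E) + k * E + k * q * E ≡ q * ((q + 1) * E) + suc k * ((q + 1) * E)
    regroup = solve-∀
    expand : ∀ q E k X → q * (X * (q + 1) + k * E) + suc k * ((q + 1) * E)
                         ≡ q * X * (q + 1) + suc k * ((q + 1) * E) + k * q * E
    expand = solve-∀

  2*x^x≤[x+1]^x : ∀ x .{{_ : NonZero x}} → 2 * x ^ x ≤ (x + 1) ^ x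
  2*x^x≤[x+1]^x x = *-cancelʳ-≤ (2 * x ^ x) ((x + 1) ^ x) x (begin
    2 * x ^ x * x     ≡⟨ double (x ^ x) x ⟩
    x ^ x * (x + x)   ≤⟨ bernoulli x x ⟩
    (x + 1) ^ x * x   ∎)
    where
    open ≤-Reasoning
    double : ∀ X x → 2 * X * x ≡ X * (x + x)
    double = solve-∀

  -- (1 + 1/a)^a < (1 + 1/(a+1))^(a+1), denominators cleared; by Bernoulli applied to (1 - 1/(a+1)^2)^a.
  compound-interest-increasing : ∀ a → suc a ^ a * suc a ^ suc a < suc (suc a) ^ suc a * a ^ a
  compound-interest-increasing a = *-cancelʳ-< (K * K) _ _ (begin-strict
    K ^ a * K ^ K * (K * K)          ≡⟨ regroup K (K ^ a) ⟩
    K * K * K * (K ^ a * K ^ a)      ≡⟨ cong (K * K * K *_) (^-distribʳ-* K K a) ⟨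
    K * K * K * S                    <⟨ +-monoˡ-≤ (K * K * K * S) (m^n>0 (K * K) a) ⟩
    S + K * K * K * S                ≤⟨ +-cancelʳ-≤ (suc K * a * S) _ _ cleared ⟩
    suc K ^ K * a ^ a * (K * K)      ∎)
    where
    open ≤-Reasoning
    K = suc a
    S = (K * K) ^ a
    Q = a * suc K
    Q+1≡K*K : Q + 1 ≡ K * K
    Q+1≡K*K = identity a
      where
      identity : ∀ a → a * (2 + a) + 1 ≡ (1 + a) * (1 + a)
      identity = solve-∀
    regroup : ∀ K X → X * (K * X) * (K * K) ≡ K * K * K * (X * X)
    regroup = solve-∀
    cleared : S + K * K * K * S + suc K * a * S ≤ suc K ^ K * a ^ a * (K * K) + suc K * a * S
    cleared = begin
      S + K * K * K * S + suc K * a * S              ≡⟨ expand a S ⟩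
      suc K * (K * K * S)                            ≤⟨ *-monoʳ-≤ (suc K) (subst (λ z → z * z ^ a ≤ Q ^ a * z + a * z ^ a)
                                                                                Q+1≡K*K (bernoulli-down Q a)) ⟩
      suc K * (Q ^ a * (K * K) + a * S)              ≡⟨ cong (λ z → suc K * (z * (K * K) + a * S)) (^-distribʳ-* a (suc K) a) ⟩
      suc K * (a ^ a * suc K ^ a * (K * K) + a * S)  ≡⟨ collect (K * K) (suc K) a (a ^ a) (suc K ^ a) S ⟩
      suc K ^ K * a ^ a * (K * K) + suc K * a * S    ∎
      where
      expand : ∀ a S → S + (1 + a) * (1 + a) * (1 + a) * S + (2 + a) * a * S ≡ (2 + a) * ((1 + a) * (1 + a) * S)
      expand = solve-∀
      collect : ∀ C K′ a X Y S → K′ * (X * Y * C + a * S) ≡ K′ * Y * X * C + K′ * a * S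
      collect = solve-∀

  p^m*[1+k]≤[p+1]^m*k : ∀ p k m .{{_ : NonZero p}} → p + 1 ≡ k * m → p ^ m * suc k ≤ (p + 1) ^ m * k
  p^m*[1+k]≤[p+1]^m*k p k m p+1≡km = *-cancelʳ-≤ (p ^ m * suc k) ((p + 1) ^ m * k) p (begin
    p ^ m * suc k * p        ≡⟨ *-assoc (p ^ m) (suc k) p ⟩
    p ^ m * (suc k * p)      ≤⟨ *-monoʳ-≤ (p ^ m) (≤-trans (m≤m+n (suc k * p) 1) (≤-reflexive [1+k]p+1≡[p+m]k)) ⟩
    p ^ m * ((p + m) * k)    ≡⟨ *-assoc (p ^ m) (p + m) k ⟨
    p ^ m * (p + m) * k      ≤⟨ *-monoˡ-≤ k (bernoulli p m) ⟩
    (p + 1) ^ m * p * k      ≡⟨ swap ((p + 1) ^ m) p k ⟩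
    (p + 1) ^ m * k * p      ∎)
    where
    open ≤-Reasoning
    swap : ∀ X p k → X * p * k ≡ X * k * p
    swap = solve-∀
    [1+k]p+1≡[p+m]k : suc k * p + 1 ≡ (p + m) * k
    [1+k]p+1≡[p+m]k = begin-equality
      suc k * p + 1            ≡⟨ rearrange k p ⟩
      p * k + (p + 1)          ≡⟨ cong (p * k +_) p+1≡km ⟩
      p * k + k * m            ≡⟨ distrib p k m ⟩
      (p + m) * k              ∎
      where
      rearrange : ∀ k p → suc k * p + 1 ≡ p * k + (p + 1)
      rearrange = solve-∀
      distrib : ∀ p k m → p * k + k * m ≡ (p + m) * k
      distrib = solve-∀

  p^km*[1+k]^k≤[p+1]^km*k^k : ∀ p k m .{{_ : NonZero p}} → p + 1 ≡ k * m →
                              p ^ (k * m) * suc k ^ k ≤ (p + 1) ^ (k * m) * k ^ k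
  p^km*[1+k]^k≤[p+1]^km*k^k p k m p+1≡km = begin
    p ^ (k * m) * suc k ^ k              ≡⟨ cong (λ e → p ^ e * suc k ^ k) (*-comm k m) ⟩
    p ^ (m * k) * suc k ^ k              ≡⟨ cong (_* suc k ^ k) (^-*-assoc p m k) ⟨
    (p ^ m) ^ k * suc k ^ k              ≡⟨ ^-distribʳ-* (p ^ m) (suc k) k ⟨
    (p ^ m * suc k) ^ k                  ≤⟨ ^-monoˡ-≤ k (p^m*[1+k]≤[p+1]^m*k p k m p+1≡km) ⟩
    ((p + 1) ^ m * k) ^ k                ≡⟨ ^-distribʳ-* ((p + 1) ^ m) k k ⟩
    ((p + 1) ^ m) ^ k * k ^ k            ≡⟨ cong (_* k ^ k) (^-*-assoc (p + 1) m k) ⟩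
    (p + 1) ^ (m * k) * k ^ k            ≡⟨ cong (λ e → (p + 1) ^ e * k ^ k) (*-comm m k) ⟩
    (p + 1) ^ (k * m) * k ^ k            ∎
    where open ≤-Reasoning

  m/o<n⇒m<n*o : ∀ {m n o} .{{_ : NonZero o}} → m / o < n → m < n * o
  m/o<n⇒m<n*o {m} {n} {o} m/o<n with m <? n * o
  ... | yes m<no = m<no
  ... | no  m≮no = contradiction m/o<n (≤⇒≯ (subst (_≤ m / o) (m*n/n≡m n o) (/-monoˡ-≤ o (≮⇒≥ m≮no))))

  -- P = L − 1, and α < β says (1 + 1/a)^a (1 − 1/L)^L < 1.
  module TailConstants (a′ m′ : ℕ) where

    a K m L P α β : ℕ
    a = suc a′
    K = suc a
    m = suc m′
    L = K * m
    P = a + m′ * K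
    α = K ^ a * P ^ L
    β = a ^ a * L ^ L

    P+1≡L : P + 1 ≡ L
    P+1≡L = identity a′ m′
      where
      identity : ∀ a′ m′ → (1 + a′) + m′ * (2 + a′) + 1 ≡ (2 + a′) * (1 + m′)
      identity = solve-∀

    P≤L : P ≤ L
    P≤L = ≤-trans (m≤m+n P 1) (≤-reflexive P+1≡L)

    α<β : α < β
    α<β = *-cancelʳ-< (K ^ K) α β (begin-strict
      K ^ a * P ^ L * K ^ K            ≡⟨ rotate (K ^ a) (P ^ L) (K ^ K) ⟩
      P ^ L * (K ^ a * K ^ K)          <⟨ *-monoʳ-< (P ^ L) {{m^n≢0 P L}} (compound-interest-increasing a) ⟩
      P ^ L * (suc K ^ K * a ^ a)      ≡⟨ rotate′ (P ^ L) (suc K ^ K) (a ^ a) ⟩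
      a ^ a * (P ^ L * suc K ^ K)      ≤⟨ *-monoʳ-≤ (a ^ a) (p^km*[1+k]^k≤[p+1]^km*k^k P K m P+1≡L) ⟩
      a ^ a * ((P + 1) ^ L * K ^ K)    ≡⟨ cong (λ x → a ^ a * (x ^ L * K ^ K)) P+1≡L ⟩
      a ^ a * (L ^ L * K ^ K)          ≡⟨ *-assoc (a ^ a) (L ^ L) (K ^ K) ⟨
      a ^ a * L ^ L * K ^ K            ∎)
      where
      open ≤-Reasoning
      rotate : ∀ x y z → x * y * z ≡ y * (x * z)
      rotate = solve-∀
      rotate′ : ∀ x y z → x * (y * z) ≡ z * (x * y)
      rotate′ = solve-∀

    instance
      α≢0 : NonZero α
      α≢0 = m*n≢0 (K ^ a) (P ^ L) {{m^n≢0 K a}} {{m^n≢0 P L}}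

    2*α^α≤β^α : 2 * α ^ α ≤ β ^ α
    2*α^α≤β^α = ≤-trans (2*x^x≤[x+1]^x α) (^-monoˡ-≤ α (subst (_≤ β) (+-comm 1 α) α<β))

    polynomial-beaten : ∀ n δ → 2 ≤ n → m ≤ n → n ^ (2 * L * α + 1) ≤ 2 ^ δ → (n * m) ^ L * α ^ δ < β ^ δ
    polynomial-beaten n δ 2≤n m≤n nᴹ≤2^δ = ^-cancelʳ-< α (begin-strict
      ((n * m) ^ L * α ^ δ) ^ α          ≡⟨ ^-distribʳ-* ((n * m) ^ L) (α ^ δ) α ⟩
      ((n * m) ^ L) ^ α * (α ^ δ) ^ α    ≡⟨ cong₂ _*_ (^-*-assoc (n * m) L α) (^-*-assoc α δ α) ⟩
      (n * m) ^ E * α ^ (δ * α)          ≤⟨ *-monoˡ-≤ (α ^ (δ * α)) (^-monoˡ-≤ E (*-monoʳ-≤ n m≤n)) ⟩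
      (n * n) ^ E * α ^ (δ * α)          ≡⟨ cong (_* α ^ (δ * α)) (trans (^-distribʳ-* n n E) (sym (^-distribˡ-+-* n E E))) ⟩
      n ^ (E + E) * α ^ (δ * α)          <⟨ *-monoˡ-< (α ^ (δ * α)) {{m^n≢0 α (δ * α)}} nᴱ⁺ᴱ<nᴹ ⟩
      n ^ (2 * L * α + 1) * α ^ (δ * α)  ≤⟨ *-monoˡ-≤ (α ^ (δ * α)) nᴹ≤2^δ ⟩
      2 ^ δ * α ^ (δ * α)                ≡⟨ cong (2 ^ δ *_) (trans (cong (α ^_) (*-comm δ α)) (sym (^-*-assoc α α δ))) ⟩
      2 ^ δ * (α ^ α) ^ δ                ≡⟨ ^-distribʳ-* 2 (α ^ α) δ ⟨
      (2 * α ^ α) ^ δ                    ≤⟨ ^-monoˡ-≤ δ 2*α^α≤β^α ⟩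
      (β ^ α) ^ δ                        ≡⟨ trans (^-*-assoc β α δ) (trans (cong (β ^_) (*-comm α δ)) (sym (^-*-assoc β δ α))) ⟩
      (β ^ δ) ^ α                        ∎)
      where
      open ≤-Reasoning
      E = L * α
      nᴱ⁺ᴱ<nᴹ : n ^ (E + E) < n ^ (2 * L * α + 1)
      nᴱ⁺ᴱ<nᴹ = subst (n ^ (E + E) <_) (cong (n ^_) (exponent L α))
                  (^-monoʳ-< n 2≤n (n<1+n (E + E)))
        where
        exponent : ∀ L α → suc (L * α + L * α) ≡ 2 * L * α + 1
        exponent = solve-∀

    tail-bound-at : ∀ X δ T → T * L ≤ a * δ → X ^ L * α ^ δ < β ^ δ → X * K ^ T * P ^ δ < a ^ T * L ^ δ
    tail-bound-at X δ T TL≤aδ Xᴸαᵟ<βᵟ = ^-cancelʳ-< L (*-cancelʳ-< (K ^ r) _ _ (begin-strict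
      (X * K ^ T * P ^ δ) ^ L * K ^ r              ≡⟨ cong (_* K ^ r) (trans (^-distribʳ-* (X * K ^ T) (P ^ δ) L)
                                                                           (cong (_* (P ^ δ) ^ L) (^-distribʳ-* X (K ^ T) L))) ⟩
      X ^ L * (K ^ T) ^ L * (P ^ δ) ^ L * K ^ r    ≡⟨ cong₂ (λ x y → X ^ L * x * y * K ^ r) (^-*-assoc K T L)
                                                            (trans (^-*-assoc P δ L) (cong (P ^_) (*-comm δ L))) ⟩
      X ^ L * K ^ (T * L) * P ^ (L * δ) * K ^ r    ≡⟨ regroup (X ^ L) (K ^ (T * L)) (P ^ (L * δ)) (K ^ r) ⟩
      X ^ L * (K ^ (T * L) * K ^ r * P ^ (L * δ))  ≡⟨ cong (λ x → X ^ L * (x * P ^ (L * δ)))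
                                                            (trans (sym (^-distribˡ-+-* K (T * L) r)) (cong (K ^_) TL+r≡aδ)) ⟩
      X ^ L * (K ^ (a * δ) * P ^ (L * δ))          ≡⟨ cong (X ^ L *_) (sym (trans (^-distribʳ-* (K ^ a) (P ^ L) δ)
                                                            (cong₂ _*_ (^-*-assoc K a δ) (^-*-assoc P L δ)))) ⟩
      X ^ L * α ^ δ                                <⟨ Xᴸαᵟ<βᵟ ⟩
      β ^ δ                                        ≡⟨ ^-distribʳ-* (a ^ a) (L ^ L) δ ⟩
      (a ^ a) ^ δ * (L ^ L) ^ δ                    ≡⟨ cong₂ _*_ (trans (^-*-assoc a a δ) (cong (a ^_) (sym TL+r≡aδ)))
                                                                (^-*-assoc L L δ) ⟩
      a ^ (T * L + r) * L ^ (L * δ)                ≡⟨ cong (_* L ^ (L * δ)) (^-distribˡ-+-* a (T * L) r) ⟩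
      a ^ (T * L) * a ^ r * L ^ (L * δ)            ≤⟨ *-monoˡ-≤ (L ^ (L * δ)) (*-monoʳ-≤ (a ^ (T * L)) (^-monoˡ-≤ r (n≤1+n a))) ⟩
      a ^ (T * L) * K ^ r * L ^ (L * δ)            ≡⟨ swap (a ^ (T * L)) (K ^ r) (L ^ (L * δ)) ⟩
      a ^ (T * L) * L ^ (L * δ) * K ^ r            ≡⟨ cong (_* K ^ r) (cong₂ _*_ (sym (^-*-assoc a T L))
                                                       (trans (cong (L ^_) (*-comm L δ)) (sym (^-*-assoc L δ L)))) ⟩
      (a ^ T) ^ L * (L ^ δ) ^ L * K ^ r            ≡⟨ cong (_* K ^ r) (^-distribʳ-* (a ^ T) (L ^ δ) L) ⟨
      (a ^ T * L ^ δ) ^ L * K ^ r                  ∎))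
      where
      open ≤-Reasoning
      r = a * δ ∸ T * L
      TL+r≡aδ : T * L + r ≡ a * δ
      TL+r≡aδ = m+[n∸m]≡n TL≤aδ
      regroup : ∀ A B C D → A * B * C * D ≡ A * (B * D * C)
      regroup = solve-∀
      swap : ∀ A B C → A * B * C ≡ A * C * B
      swap = solve-∀

    tail-bound-mono : ∀ Y T {δ d} → δ ≤ d → Y * K ^ T * P ^ δ < a ^ T * L ^ δ → Y * K ^ T * P ^ d < a ^ T * L ^ d
    tail-bound-mono Y T {δ} {d} δ≤d small = begin-strict
      Y * K ^ T * P ^ d              ≡⟨ cong (λ e → Y * K ^ T * P ^ e) (sym δ+e≡d) ⟩
      Y * K ^ T * P ^ (δ + e)        ≡⟨ cong (Y * K ^ T *_) (^-distribˡ-+-* P δ e) ⟩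
      Y * K ^ T * (P ^ δ * P ^ e)    ≡⟨ *-assoc (Y * K ^ T) (P ^ δ) (P ^ e) ⟨
      Y * K ^ T * P ^ δ * P ^ e      <⟨ *-monoˡ-< (P ^ e) {{m^n≢0 P e}} small ⟩
      a ^ T * L ^ δ * P ^ e          ≤⟨ *-monoʳ-≤ (a ^ T * L ^ δ) (^-monoˡ-≤ e P≤L) ⟩
      a ^ T * L ^ δ * L ^ e          ≡⟨ *-assoc (a ^ T) (L ^ δ) (L ^ e) ⟩
      a ^ T * (L ^ δ * L ^ e)        ≡⟨ cong (a ^ T *_) (trans (sym (^-distribˡ-+-* L δ e)) (cong (L ^_) δ+e≡d)) ⟩
      a ^ T * L ^ d                  ∎
      where
      open ≤-Reasoning
      e = d ∸ δ
      δ+e≡d : δ + e ≡ d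
      δ+e≡d = m+[n∸m]≡n δ≤d

    tail-bound : ∀ n δ d e T → 2 ≤ n → m ≤ n → n ^ (2 * L * α + 1) ≤ 2 ^ δ → δ ≤ d → T * L ≤ a * δ →
                 n * (K ^ T * (m * (P ^ d * m ^ e))) < a ^ T * K ^ d * m ^ (d + e)
    tail-bound n δ d e T 2≤n m≤n nᴹ≤2^δ δ≤d TL≤aδ = begin-strict
      n * (K ^ T * (m * (P ^ d * m ^ e)))  ≡⟨ regroup n (K ^ T) m (P ^ d) (m ^ e) ⟩
      n * m * K ^ T * P ^ d * m ^ e        <⟨ *-monoˡ-< (m ^ e) {{m^n≢0 m e}} small ⟩
      a ^ T * L ^ d * m ^ e                ≡⟨ cong (λ x → a ^ T * x * m ^ e) (^-distribʳ-* K m d) ⟩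
      a ^ T * (K ^ d * m ^ d) * m ^ e      ≡⟨ regroup′ (a ^ T) (K ^ d) (m ^ d) (m ^ e) ⟩
      a ^ T * K ^ d * (m ^ d * m ^ e)      ≡⟨ cong (a ^ T * K ^ d *_) (^-distribˡ-+-* m d e) ⟨
      a ^ T * K ^ d * m ^ (d + e)          ∎
      where
      open ≤-Reasoning
      small : n * m * K ^ T * P ^ d < a ^ T * L ^ d
      small = tail-bound-mono (n * m) T δ≤d
                (tail-bound-at (n * m) δ T TL≤aδ (polynomial-beaten n δ 2≤n m≤n nᴹ≤2^δ))
      regroup : ∀ n A m B C → n * (A * (m * (B * C))) ≡ n * m * A * B * C
      regroup = solve-∀
      regroup′ : ∀ A B C D → A * (B * C) * D ≡ A * B * (C * D)
      regroup′ = solve-∀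

module RationalScaling where

  open import Data.Nat as ℕ using (ℕ; suc)
  import Data.Nat.Properties as ℕ
  open import Data.Integer as ℤ using (+_; +0; +[1+_]; -[1+_])
  import Data.Integer.Properties as ℤ
  open import Data.Integer.Tactic.RingSolver using (solve-∀)
  open import Data.Rational as ℚ using (ℚ; mkℚ; 0ℚ; 1ℚ; _/_; _-_; _<_; _≤_; _*_; ↧ₙ_; toℚᵘ; *<*)
  open import Data.Rational.Properties using (toℚᵘ-cancel-≤; toℚᵘ-homo-*; toℚᵘ-homo-+; toℚᵘ-homo‿-; normalize-coprime)
  open import Data.Rational.Unnormalised as ℚᵘ using (mkℚᵘ; _≃_; *≤*) renaming (_≤_ to _≤ᵘ_)
  import Data.Rational.Unnormalised.Properties as ℚᵘ
  open import Data.Nat.Coprimality using (1-coprimeTo) renaming (sym to coprime-sym)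
  open import Data.Sum using (inj₁; inj₂)
  open import Relation.Binary.PropositionalEquality

  toℚᵘ-/1 : ∀ n → toℚᵘ ((+ n) / 1) ≡ mkℚᵘ (+ n) 0
  toℚᵘ-/1 n = cong toℚᵘ (normalize-coprime (coprime-sym (1-coprimeTo n)))

  q*D≤[1+p]*D+q*Y : ∀ p q D Y → q ℕ.* D ℕ.≤ suc q ℕ.* Y → q ℕ.* D ℕ.≤ suc p ℕ.* D ℕ.+ q ℕ.* Y
  q*D≤[1+p]*D+q*Y p q D Y qD≤[1+q]Y with ℕ.≤-total D Y
  ... | inj₁ D≤Y = ℕ.≤-trans (ℕ.*-monoʳ-≤ q D≤Y) (ℕ.m≤n+m (q ℕ.* Y) (suc p ℕ.* D))
  ... | inj₂ Y≤D = ℕ.≤-trans qD≤[1+q]Y (ℕ.+-monoˡ-≤ (q ℕ.* Y) (ℕ.≤-trans Y≤D (ℕ.m≤n*m D (suc p))))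

  -- For ε = p/q with p ≥ 1: 1 − ε ≤ 1 − 1/q ≤ q/(q + 1).
  1-ε-scale-≤ : ∀ (ε : ℚ) → 0ℚ < ε → ∀ D Y → ↧ₙ ε ℕ.* D ℕ.≤ suc (↧ₙ ε) ℕ.* Y →
                (1ℚ - ε) * ((+ D) / 1) ≤ (+ Y) / 1
  1-ε-scale-≤ (mkℚ +0       _   _) (*<* (ℤ.+<+ ())) D Y _
  1-ε-scale-≤ (mkℚ -[1+ _ ] _   _) (*<* ())   D Y _
  1-ε-scale-≤ ε@(mkℚ +[1+ p ] q-1 _) _ D Y qD≤[1+q]Y =
    toℚᵘ-cancel-≤ (ℚᵘ.≤-respˡ-≃ (ℚᵘ.≃-sym lhs≃) (subst (_ ≤ᵘ_) (sym (toℚᵘ-/1 Y)) (*≤* cleared)))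
    where
    q = suc q-1
    1ᵘ = mkℚᵘ (+ 1) 0
    lhs≃ : toℚᵘ ((1ℚ - ε) * ((+ D) / 1)) ≃ (1ᵘ ℚᵘ.+ ℚᵘ.- mkℚᵘ +[1+ p ] q-1) ℚᵘ.* mkℚᵘ (+ D) 0
    lhs≃ = ℚᵘ.≃-trans (toℚᵘ-homo-* (1ℚ - ε) ((+ D) / 1))
             (ℚᵘ.*-cong (ℚᵘ.≃-trans (toℚᵘ-homo-+ 1ℚ (ℚ.- ε)) (ℚᵘ.+-congʳ 1ᵘ (toℚᵘ-homo‿- ε)))
                        (ℚᵘ.≃-reflexive (toℚᵘ-/1 D)))
    cleared : ((+ 1 ℤ.* + q ℤ.+ -[1+ p ] ℤ.* + 1) ℤ.* + D) ℤ.* + 1 ℤ.≤ + Y ℤ.* + (1 ℕ.* q ℕ.* 1)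
    cleared = begin
      ((+ 1 ℤ.* + q ℤ.+ -[1+ p ] ℤ.* + 1) ℤ.* + D) ℤ.* + 1   ≡⟨ expand (+ q) +[1+ p ] (+ D) ⟩
      + q ℤ.* + D ℤ.- + suc p ℤ.* + D                         ≡⟨ cong₂ ℤ._-_ (ℤ.pos-* q D) (ℤ.pos-* (suc p) D) ⟨
      + (q ℕ.* D) ℤ.- + (suc p ℕ.* D)                         ≤⟨ ℤ.+-monoˡ-≤ (ℤ.- + (suc p ℕ.* D)) (ℤ.+≤+ (q*D≤[1+p]*D+q*Y p q D Y qD≤[1+q]Y)) ⟩
      + (suc p ℕ.* D ℕ.+ q ℕ.* Y) ℤ.- + (suc p ℕ.* D)         ≡⟨ cong (ℤ._- + (suc p ℕ.* D)) (ℤ.pos-+ (suc p ℕ.* D) (q ℕ.* Y)) ⟩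
      + (suc p ℕ.* D) ℤ.+ + (q ℕ.* Y) ℤ.- + (suc p ℕ.* D)     ≡⟨ cancel (+ (suc p ℕ.* D)) (+ (q ℕ.* Y)) ⟩
      + (q ℕ.* Y)                                             ≡⟨ cong +_ (trans (ℕ.*-comm q Y) (cong (Y ℕ.*_) (sym 1*q*1≡q))) ⟩
      + (Y ℕ.* (1 ℕ.* q ℕ.* 1))                               ≡⟨ ℤ.pos-* Y (1 ℕ.* q ℕ.* 1) ⟩
      + Y ℤ.* + (1 ℕ.* q ℕ.* 1)                               ∎
      where
      open ℤ.≤-Reasoning
      expand : ∀ q p d → ((+ 1 ℤ.* q ℤ.+ (ℤ.- p) ℤ.* + 1) ℤ.* d) ℤ.* + 1 ≡ q ℤ.* d ℤ.- p ℤ.* d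
      expand = solve-∀
      cancel : ∀ v w → v ℤ.+ w ℤ.- v ≡ w
      cancel = solve-∀
      1*q*1≡q : 1 ℕ.* q ℕ.* 1 ≡ q
      1*q*1≡q = trans (ℕ.*-identityʳ (1 ℕ.* q)) (ℕ.*-identityˡ q)

module Sparsification where

  open FiniteSums
  open Colourings
  open CyclicWalks using (cyclicSuc)
  open TailEstimate using (module TailConstants; m/o<n⇒m<n*o)
  open import Defs using (Digraph; Loopless; MinOutdegAtLeast)
  open import Data.Bool using (false; not)
  open import Data.Nat using (ℕ; _+_; _*_; _^_; _≤_; _<_; _≤?_; s≤s; z≤n; >-nonZero)
  open import Data.Nat.DivMod using (_/_; m/n*n≤m)
  open import Data.Nat.Properties
  open import Data.Nat.Tactic.RingSolver using (solve-∀)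
  open import Data.Product using (∃; _,_; proj₁; proj₂)
  open import Function using (_∘_)
  open import Relation.Binary.PropositionalEquality
  open import Relation.Nullary using (does; ¬_)

  module _ (a′ m′ : ℕ) where

    open TailConstants a′ m′

    few-hits-rare : ∀ {n} (G : Digraph n) u → G u u ≡ false → ∀ δ → δ ≤ count (G u) →
                    2 ≤ n → m ≤ n → n ^ (2 * L * α + 1) ≤ 2 ^ δ →
                    n * ∑-colourings m n (λ c → indicator (does (hits cyclicSuc c G u ≤? (a * δ) / L))) < m ^ n
    few-hits-rare {n} G u G-u-u δ δ≤d 2≤n m≤n nᴹ≤2^δ = *-cancelʳ-< X (n * F) (m ^ n) (begin-strict
      n * F * X                               ≡⟨ *-assoc n F X ⟩
      n * (F * X)                             ≤⟨ *-monoʳ-≤ n (few-hits-≤ cyclicSuc G u G-u-u a K (n≤1+n a) T) ⟩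
      n * (K ^ T * (m * (P ^ d * m ^ d̄)))     <⟨ tail-bound n δ d d̄ T 2≤n m≤n nᴹ≤2^δ δ≤d (m/n*n≤m (a * δ) L) ⟩
      X * m ^ (d + d̄)                         ≡⟨ cong (λ e → X * m ^ e) (count+count-not (G u)) ⟩
      X * m ^ n                               ≡⟨ *-comm X (m ^ n) ⟩
      m ^ n * X                               ∎)
      where
      open ≤-Reasoning
      T = (a * δ) / L
      d = count (G u)
      d̄ = count (not ∘ G u)
      X = a ^ T * K ^ d
      F = ∑-colourings m n (λ c → indicator (does (hits cyclicSuc c G u ≤? T)))

    many-hits-colouring : ∀ {n} (G : Digraph n) → Loopless G → ∀ δ → MinOutdegAtLeast G δ →
                          2 ≤ n → m ≤ n → n ^ (2 * L * α + 1) ≤ 2 ^ δ →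
                          ∃ λ c → ∀ u → a * δ ≤ K * (m * hits cyclicSuc c G u)
    many-hits-colouring {n} G loopless δ minOut 2≤n m≤n nᴹ≤2^δ = c , λ u →
      ≤-trans (<⇒≤ (m/o<n⇒m<n*o {a * δ} {hits cyclicSuc c G u} {L} (≰⇒> (proj₂ good u))))
              (≤-reflexive (regroup (hits cyclicSuc c G u) K m))
      where
      good : ∃ λ c → ∀ u → ¬ hits cyclicSuc c G u ≤ (a * δ) / L
      good = good-colouring-exists {{>-nonZero (≤-trans (s≤s z≤n) 2≤n)}}
               (λ u c → hits cyclicSuc c G u ≤? (a * δ) / L)
               (λ u → few-hits-rare G u (loopless u) δ (subst (δ ≤_) (countTrue≡count (G u)) (minOut u)) 2≤n m≤n nᴹ≤2^δ)
      c = proj₁ good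
      regroup : ∀ z K m → z * (K * m) ≡ K * (m * z)
      regroup = solve-∀

open import Defs
open import Data.Nat using (ℕ; suc; _≤_; _*_; _∸_)
open import Data.Integer using (+_)
open import Data.Rational using (ℚ; 0ℚ; 1ℚ; _/_; _-_; _<_) renaming (_*_ to _*ℚ_; _≤_ to _≤ℚ_)
open import Data.Product using (Σ; _×_; ∃)
open import Relation.Binary.PropositionalEquality using (_≡_)

open import Data.Nat using (_+_)
open import Data.Nat.Properties using (≤-trans; m≤m+n; m≤n+m)
open import Data.Product using (_,_; proj₁; proj₂)
open import Relation.Binary.PropositionalEquality using (sym; subst)
open FiniteSums using (countTrue≡count)
open Colourings using (colourSubgraph; colourSubgraph-⊆; colourSubgraph-arc; hits)
open CyclicWalks using (cyclicSuc; closedWalk-type-zero)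
open TailEstimate using (module TailConstants)
open Sparsification using (many-hits-colouring)
open RationalScaling using (1-ε-scale-≤)

lemma7p2 : ∀ (h : ℕ) → 1 ≤ h → ∀ (ε : ℚ) → 0ℚ < ε →
    ∀ (δ : ℕ → ℕ) → SuperLog δ →
    ∃ λ N → ∀ n → N ≤ n →
      ∀ (G : Digraph n) → Loopless G → MinOutdegAtLeast G (δ n) →
      Σ (Digraph n) λ G' → SpanningSub G' G ×
        (∀ u → ((1ℚ - ε) *ℚ ((+ δ n) / 1)) ≤ℚ ((+ (2 * h * outdeg G' u)) / 1)) ×
        (∀ s → s ≤ 2 * h ∸ 1 → (W : ClosedWalk G' s) → walkType W ≡ 0)
lemma7p2 (suc h′) _ ε 0<ε δ superLog = N₀ + (m + 2) , sparsify
  where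
  a′ = ℚ.denominator-1 ε
  -- Chosen so that suc m′ and 2 * suc h′ ∸ 1 reduce to 2 * suc h′ and m′.
  m′ = h′ + (suc h′ + 0)
  open TailConstants a′ m′
  N₀ = proj₁ (superLog (2 * L * α + 1))
  sparsify : ∀ n → N₀ + (m + 2) ≤ n →
    ∀ (G : Digraph n) → Loopless G → MinOutdegAtLeast G (δ n) →
    Σ (Digraph n) λ G' → SpanningSub G' G ×
      (∀ u → ((1ℚ - ε) *ℚ ((+ δ n) / 1)) ≤ℚ ((+ (2 * suc h′ * outdeg G' u)) / 1)) ×
      (∀ s → s ≤ 2 * suc h′ ∸ 1 → (W : ClosedWalk G' s) → walkType W ≡ 0)
  sparsify n N≤n G loopless minOut =
    colourSubgraph cyclicSuc c G , colourSubgraph-⊆ cyclicSuc c G ,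
    (λ u → subst (λ k → (1ℚ - ε) *ℚ ((+ δ n) / 1) ≤ℚ (+ (m * k)) / 1) (sym (countTrue≡count (colourSubgraph cyclicSuc c G u)))
                 (1-ε-scale-≤ ε 0<ε (δ n) (m * hits cyclicSuc c G u) (many-hits u))) ,
    (λ s s≤m′ → closedWalk-type-zero c (colourSubgraph cyclicSuc c G) (colourSubgraph-arc cyclicSuc c G) s≤m′)
    where
    m+2≤n : m + 2 ≤ n
    m+2≤n = ≤-trans (m≤n+m (m + 2) N₀) N≤n
    colouring : ∃ λ c → ∀ u → a * δ n ≤ K * (m * hits cyclicSuc c G u)
    colouring = many-hits-colouring a′ m′ G loopless (δ n) minOut (≤-trans (m≤n+m 2 m) m+2≤n) (≤-trans (m≤m+n m 2) m+2≤n)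
                  (proj₂ (superLog (2 * L * α + 1)) n (≤-trans (m≤m+n N₀ (m + 2)) N≤n))
    c = proj₁ colouring
    many-hits = proj₂ colouring
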